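{- Let $k \geq 1$ be an integer and $p \geq 1$ an odd integer, and let $M_k(p,t^*)\in\mathbb{R}^{(k+1)\times(k+1)}$ (indices $0,\dots,k$) be \[ M_k(p,t^*)_{i,j} := \sum_{\ell=0}^{k} \binom{i}{\ell} \binom{k-i}{j-\ell} \cdot \big|2i + 2j -k-4\ell - t^*\big|^p . \] Then the function $t^* \mapsto \det(M_k(p,t^*))$, restricted to the interval $t^* \in [-k,-k+2]$, is a polynomial of degree at most $(k+1)p$, and the coefficient of $(t^*)^{(k+1)p}$ in this polynomial is exactly $2^k(2-2^k)$. In particular, for $k \geq 2$, $t^* \mapsto \det(M_k(p,t^*))$ is a non-zero polynomial of degree $(k+1)p$ on the interval $[-k,-k+2]$.
   Context: The convention $\binom{i}{j}=0$ if $j>i$, $j<0$ or $j\notin\mathbb{Z}$ is used.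
   Formalization: The variable $t^*$ ranges over the rationals in $[-k,-k+2]$ instead of the reals, so the entries of $M_k(p,t^*)$ and the coefficients of the polynomial are taken in ℚ. -}

module Defs where

open import Data.Nat as ℕ using (ℕ; zero; suc)
open import Data.Nat.Combinatorics using (_C_)
open import Data.Integer as ℤ using (ℤ; +_; -[1+_])
open import Data.Fin using (Fin; zero; suc; toℕ; punchIn)
open import Data.Product using (∃)
open import Relation.Binary.PropositionalEquality using (_≡_)
open import Data.Rational as ℚ using (ℚ; _/_; 0ℚ; 1ℚ)

Odd : ℕ → Set
Odd p = ∃ λ m → p ≡ suc (2 ℕ.* m)

-- binomial coefficient with integer lower index; 0 if j < 0 or j > i
binom : ℕ → ℤ → ℕ
binom i (+ j)    = i C j     -- stdlib: i C j = 0 when j > i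
binom i -[1+ _ ] = 0

ℕ→ℚ : ℕ → ℚ
ℕ→ℚ n = + n / 1

ℤ→ℚ : ℤ → ℚ
ℤ→ℚ z = z / 1

_^ℚ_ : ℚ → ℕ → ℚ
x ^ℚ zero  = 1ℚ
x ^ℚ suc n = x ℚ.* (x ^ℚ n)

∑ : (n : ℕ) → (Fin n → ℚ) → ℚ
∑ zero    f = 0ℚ
∑ (suc n) f = f zero ℚ.+ ∑ n (λ i → f (suc i))

sgn : ℕ → ℚ
sgn zero    = 1ℚ
sgn (suc j) = ℚ.- sgn j

det : (n : ℕ) → (Fin n → Fin n → ℚ) → ℚ
det zero    M = 1ℚ
det (suc n) M = ∑ (suc n) λ j →
  sgn (toℕ j) ℚ.* M zero j ℚ.* det n (λ r c → M (suc r) (punchIn j c))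

Mk : (k p : ℕ) → ℚ → Fin (suc k) → Fin (suc k) → ℚ
Mk k p t i j = ∑ (suc k) λ ℓ →
  ℕ→ℚ (binom (toℕ i) (+ toℕ ℓ) ℕ.* binom (k ℕ.∸ toℕ i) (+ toℕ j ℤ.- + toℕ ℓ))
  ℚ.* (ℚ.∣ ℤ→ℚ (+ (2 ℕ.* toℕ i ℕ.+ 2 ℕ.* toℕ j) ℤ.- + k ℤ.- + (4 ℕ.* toℕ ℓ)) ℚ.- t ∣ ^ℚ p)

evalPoly : (D : ℕ) → (Fin (suc D) → ℚ) → ℚ → ℚ
evalPoly D c t = ∑ (suc D) λ i → c i ℚ.* (t ^ℚ toℕ i)

module Submission where

-- Write x = 2i+2j-k-4ℓ for the node of term ℓ in entry (i,j) of M_k.  For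
-- -k ≤ t ≤ -k+2 the sign of x - t is fixed: x - t ≤ 0 when i + j ≤ 2ℓ and
-- x - t ≥ 0 otherwise.  As p is odd, |x - t|^p = ±(x - t)^p, so on the
-- interval every entry of M_k(p,t) is a polynomial of degree ≤ p in t whose
-- t^p-coefficient is  -Σ_ℓ c_ℓ + 2 Σ_{i+j ≤ 2ℓ} c_ℓ  with c_ℓ = C(i,ℓ)C(k-i,j-ℓ).
-- Vandermonde's convolution gives Σ_ℓ c_ℓ = C(k,j), and c_ℓ ≠ 0 together with
-- i + j ≤ 2ℓ forces ℓ = i = j, so the leading coefficient is -C(k,j) + 2δ_ij.
-- The determinant of a matrix of polynomials of degree ≤ p is a polynomial of
-- degree ≤ (k+1)p whose top coefficient is the determinant of the leading
-- coefficients, here det(2I - 𝟙wᵀ) with w_j = C(k,j); the matrix determinant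
-- lemma det(dI + 𝟙wᵀ) = d^{n+1} + d^n Σ w then yields 2^{k+1} - 2^k·2^k.

open import Defs
open import Data.Nat as ℕ using (ℕ; zero; suc; z≤n; s≤s; _≤_)
open import Data.Integer as ℤ using (ℤ; +_; -[1+_])
open import Data.Fin using (Fin; zero; suc; toℕ; punchIn; fromℕ)
open import Data.Product using (∃; _×_; _,_; proj₁; proj₂)
open import Data.Bool using (Bool; true; false; if_then_else_)
open import Data.List using (List; []; _∷_)
open import Data.Sum using (inj₁; inj₂)
open import Data.Empty using (⊥-elim)
open import Function using (_∘_)
open import Relation.Nullary using (Dec; yes; no; ¬_)
open import Relation.Binary.PropositionalEquality
open import Data.Rational as ℚ using (ℚ; 0ℚ; 1ℚ; _+_; _*_; -_; _-_; mkℚ; ↥_; ↧_)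
open import Data.Nat.Combinatorics using (_C_; nCn≡1; k>n⇒nCk≡0; nCk+nC[k+1]≡[n+1]C[k+1])
import Data.Nat.Properties as ℕP
import Data.Nat.GCD as ℕGCD
import Data.Nat.Coprimality as Coprimality
import Data.Integer.Properties as ℤP
import Data.Fin.Properties as FinP
import Data.Rational.Properties as ℚP
open import Data.Rational.Solver using (module +-*-Solver)
open +-*-Solver using (solve; _:+_; _:*_; :-_; _:=_; con)
import Data.Integer.Solver
module ℤSolver = Data.Integer.Solver.+-*-Solver

integral : ℤ → ℚ
integral a = mkℚ a 0 (Coprimality.sym (Coprimality.1-coprimeTo ℤ.∣ a ∣))

-- a / 1 is already in lowest terms; this makes the arithmetic of ℤ→ℚ compute.
ℤ→ℚ-integral : ∀ a → ℤ→ℚ a ≡ integral a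
ℤ→ℚ-integral a = fromParts (ℤ→ℚ a) (reduced (ℚP.↥-/ a 1)) (reduced (ℚP.↧-/ a 1))
  where
  reduced : ∀ {x y} → x ℤ.* + ℕGCD.gcd ℤ.∣ a ∣ 1 ≡ y → x ≡ y
  reduced {x} eq =
    trans (sym (ℤP.*-identityʳ x))
          (trans (cong (λ g → x ℤ.* + g) (sym (ℕGCD.gcd-zeroʳ ℤ.∣ a ∣))) eq)
  fromParts : ∀ q → ↥ q ≡ a → ↧ q ≡ + 1 → q ≡ integral a
  fromParts (mkℚ n zero _) refl refl = refl

ℤ→ℚ-+ : ∀ a b → ℤ→ℚ (a ℤ.+ b) ≡ ℤ→ℚ a + ℤ→ℚ b
ℤ→ℚ-+ a b =
  trans (cong ℤ→ℚ (sym (cong₂ ℤ._+_ (ℤP.*-identityʳ a) (ℤP.*-identityʳ b))))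
        (sym (cong₂ _+_ (ℤ→ℚ-integral a) (ℤ→ℚ-integral b)))

ℤ→ℚ-* : ∀ a b → ℤ→ℚ (a ℤ.* b) ≡ ℤ→ℚ a * ℤ→ℚ b
ℤ→ℚ-* a b = sym (cong₂ _*_ (ℤ→ℚ-integral a) (ℤ→ℚ-integral b))

ℤ→ℚ-neg : ∀ a → ℤ→ℚ (ℤ.- a) ≡ - ℤ→ℚ a
ℤ→ℚ-neg a =
  trans (ℤ→ℚ-integral (ℤ.- a)) (trans (integral-neg a) (cong -_ (sym (ℤ→ℚ-integral a))))
  where
  integral-neg : ∀ a → integral (ℤ.- a) ≡ - integral a
  integral-neg (+ zero)  = refl
  integral-neg (+ suc n) = refl
  integral-neg -[1+ n ]  = refl

ℤ→ℚ-- : ∀ a b → ℤ→ℚ (a ℤ.- b) ≡ ℤ→ℚ a - ℤ→ℚ b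
ℤ→ℚ-- a b = trans (ℤ→ℚ-+ a (ℤ.- b)) (cong (_+_ (ℤ→ℚ a)) (ℤ→ℚ-neg b))

ℤ→ℚ-mono : ∀ {a b} → a ℤ.≤ b → ℤ→ℚ a ℚ.≤ ℤ→ℚ b
ℤ→ℚ-mono {a} {b} a≤b rewrite ℤ→ℚ-integral a | ℤ→ℚ-integral b =
  ℚ.*≤* (subst₂ ℤ._≤_ (sym (ℤP.*-identityʳ a)) (sym (ℤP.*-identityʳ b)) a≤b)

ℤ→ℚ-zero : ∀ a → ℤ→ℚ a ≡ 0ℚ → a ≡ + 0
ℤ→ℚ-zero a eq = cong ↥_ (trans (sym (ℤ→ℚ-integral a)) eq)

ℕ→ℚ-+ : ∀ a b → ℕ→ℚ (a ℕ.+ b) ≡ ℕ→ℚ a + ℕ→ℚ b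
ℕ→ℚ-+ a b = ℤ→ℚ-+ (+ a) (+ b)

ℕ→ℚ-* : ∀ a b → ℕ→ℚ (a ℕ.* b) ≡ ℕ→ℚ a * ℕ→ℚ b
ℕ→ℚ-* a b = trans (cong ℤ→ℚ (ℤP.pos-* a b)) (ℤ→ℚ-* (+ a) (+ b))

ℕ→ℚ-^ : ∀ a n → ℕ→ℚ (a ℕ.^ n) ≡ ℕ→ℚ a ^ℚ n
ℕ→ℚ-^ a zero    = refl
ℕ→ℚ-^ a (suc n) = trans (ℕ→ℚ-* a (a ℕ.^ n)) (cong (ℕ→ℚ a *_) (ℕ→ℚ-^ a n))

ℕ→ℚ-*-distrib : ∀ x y b → ℕ→ℚ ((x ℕ.+ y) ℕ.* b) ≡ ℕ→ℚ (x ℕ.* b) + ℕ→ℚ (y ℕ.* b)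
ℕ→ℚ-*-distrib x y b = trans (cong ℕ→ℚ (ℕP.*-distribʳ-+ b x y)) (ℕ→ℚ-+ (x ℕ.* b) (y ℕ.* b))

ℕ→ℚ-mono : ∀ {a b} → a ℕ.≤ b → ℕ→ℚ a ℚ.≤ ℕ→ℚ b
ℕ→ℚ-mono a≤b = ℤ→ℚ-mono (ℤ.+≤+ a≤b)

∑-cong : ∀ n {f g : Fin n → ℚ} → (∀ i → f i ≡ g i) → ∑ n f ≡ ∑ n g
∑-cong zero    eq = refl
∑-cong (suc n) eq = cong₂ _+_ (eq zero) (∑-cong n (eq ∘ suc))

∑-zero : ∀ n {f : Fin n → ℚ} → (∀ i → f i ≡ 0ℚ) → ∑ n f ≡ 0ℚ
∑-zero zero    eq = refl
∑-zero (suc n) eq = cong₂ _+_ (eq zero) (∑-zero n (eq ∘ suc))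

∑-+ : ∀ n (f g : Fin n → ℚ) → ∑ n (λ i → f i + g i) ≡ ∑ n f + ∑ n g
∑-+ zero    f g = refl
∑-+ (suc n) f g =
  trans (cong (_+_ (f zero + g zero)) (∑-+ n (f ∘ suc) (g ∘ suc)))
        (solve 4 (λ a b c d → (a :+ b) :+ (c :+ d) := (a :+ c) :+ (b :+ d)) refl
               (f zero) (g zero) (∑ n (f ∘ suc)) (∑ n (g ∘ suc)))

∑-*ˡ : ∀ n (a : ℚ) (f : Fin n → ℚ) → ∑ n (λ i → a * f i) ≡ a * ∑ n f
∑-*ˡ zero    a f = sym (ℚP.*-zeroʳ a)
∑-*ˡ (suc n) a f =
  trans (cong (_+_ (a * f zero)) (∑-*ˡ n a (f ∘ suc))) (sym (ℚP.*-distribˡ-+ a _ _))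

-- Boolean equality of indices, which computes along suc and punchIn.
same : ∀ {n} → Fin n → Fin n → Bool
same zero    zero    = true
same zero    (suc _) = false
same (suc _) zero    = false
same (suc a) (suc b) = same a b

same-refl : ∀ {n} (a : Fin n) → same a a ≡ true
same-refl zero    = refl
same-refl (suc a) = same-refl a

same-≡ : ∀ {n} (a b : Fin n) → toℕ a ≡ toℕ b → same a b ≡ true
same-≡ a b eq = trans (cong (same a) (sym (FinP.toℕ-injective eq))) (same-refl a)

same-≢ : ∀ {n} (a b : Fin n) → toℕ a ≢ toℕ b → same a b ≡ false
same-≢ zero    zero    ne = ⊥-elim (ne refl)
same-≢ zero    (suc b) ne = refl
same-≢ (suc a) zero    ne = refl
same-≢ (suc a) (suc b) ne = same-≢ a b (ne ∘ cong suc)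

∑-δ : ∀ n (i : Fin n) x → ∑ n (λ l → if same l i then x else 0ℚ) ≡ x
∑-δ (suc n) zero    x = trans (cong (_+_ x) (∑-zero n (λ l → refl))) (ℚP.+-identityʳ x)
∑-δ (suc n) (suc i) x = trans (cong (_+_ 0ℚ) (∑-δ n i x)) (ℚP.+-identityˡ x)

Matrix : ℕ → Set
Matrix n = Fin n → Fin n → ℚ

minor : ∀ {A : Set} {n} → Fin (suc n) → (Fin (suc n) → Fin (suc n) → A) → Fin n → Fin n → A
minor j M r c = M (suc r) (punchIn j c)

det-cong : ∀ n {M N : Matrix n} → (∀ r c → M r c ≡ N r c) → det n M ≡ det n N
det-cong zero    eq = refl
det-cong (suc n) eq = ∑-cong (suc n) λ j →
  cong₂ _*_ (cong (sgn (toℕ j) *_) (eq zero j)) (det-cong n (λ r c → eq (suc r) (punchIn j c)))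

sgn-square : ∀ n → sgn n * sgn n ≡ 1ℚ
sgn-square zero    = refl
sgn-square (suc n) =
  trans (solve 1 (λ s → (:- s) :* (:- s) := s :* s) refl (sgn n)) (sgn-square n)

withColumn₀ : ∀ {m} → (Fin (suc m) → ℚ) → Matrix (suc m) → Matrix (suc m)
withColumn₀ X N r zero    = X r
withColumn₀ X N r (suc c) = N r (suc c)

minor-withColumn₀ : ∀ {m} (X : Fin (suc (suc m)) → ℚ) N (j : Fin (suc m)) r c →
  minor (suc j) (withColumn₀ X N) r c ≡ withColumn₀ (X ∘ suc) (minor (suc j) N) r c
minor-withColumn₀ X N j r zero    = refl
minor-withColumn₀ X N j r (suc c) = refl

det-scaleColumn₀ : ∀ m a (X : Fin (suc m) → ℚ) N →
  det (suc m) (withColumn₀ (λ r → a * X r) N) ≡ a * det (suc m) (withColumn₀ X N)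
det-scaleColumn₀ zero a X N =
  solve 2 (λ a x → con 1ℚ :* (a :* x) :* con 1ℚ :+ con 0ℚ
                 := a :* (con 1ℚ :* x :* con 1ℚ :+ con 0ℚ)) refl a (X zero)
det-scaleColumn₀ (suc m) a X N = begin
    lead (a * X zero) + ∑ (suc m) (λ j → term j (det (suc m) (minor (suc j) (withColumn₀ aX N))))
      ≡⟨ cong (_+_ (lead (a * X zero))) (∑-cong (suc m) scaledTerm) ⟩
    lead (a * X zero) + ∑ (suc m) (λ j → a * term j (E j))
      ≡⟨ cong (_+_ (lead (a * X zero))) (∑-*ˡ (suc m) a (λ j → term j (E j))) ⟩
    lead (a * X zero) + a * ∑ (suc m) (λ j → term j (E j))
      ≡⟨ solve 4 (λ a x d s → con 1ℚ :* (a :* x) :* d :+ a :* s := a :* (con 1ℚ :* x :* d :+ s))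
               refl a (X zero) D₀ (∑ (suc m) (λ j → term j (E j))) ⟩
    a * (lead (X zero) + ∑ (suc m) (λ j → term j (E j)))
      ≡⟨ cong (λ s → a * (lead (X zero) + s)) (sym (∑-cong (suc m) (λ j → cong (term j) (unscaled j)))) ⟩
    a * det (suc (suc m)) (withColumn₀ X N) ∎
  where
  open ≡-Reasoning
  aX : Fin (suc (suc m)) → ℚ
  aX r = a * X r
  D₀ = det (suc m) (minor zero N)
  lead : ℚ → ℚ
  lead x = 1ℚ * x * D₀
  term : Fin (suc m) → ℚ → ℚ
  term j d = sgn (toℕ (suc j)) * N zero (suc j) * d
  E : Fin (suc m) → ℚ
  E j = det (suc m) (withColumn₀ (X ∘ suc) (minor (suc j) N))
  unscaled : ∀ j → det (suc m) (minor (suc j) (withColumn₀ X N)) ≡ E j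
  unscaled j = det-cong (suc m) (minor-withColumn₀ X N j)
  scaledTerm : ∀ j → term j (det (suc m) (minor (suc j) (withColumn₀ aX N))) ≡ a * term j (E j)
  scaledTerm j =
    trans (cong (term j) (trans (det-cong (suc m) (minor-withColumn₀ aX N j))
                                (det-scaleColumn₀ m a (X ∘ suc) (minor (suc j) N))))
          (solve 4 (λ a s n d → s :* n :* (a :* d) := a :* (s :* n :* d)) refl
                 a (sgn (toℕ (suc j))) (N zero (suc j)) (E j))

laplaceTail : ∀ n → Matrix (suc (suc n)) → ℚ
laplaceTail n M =
  ∑ n (λ j → sgn (toℕ (suc (suc j))) * M zero (suc (suc j)) * det (suc n) (minor (suc (suc j)) M))

mutual
  -- A matrix whose columns 0 and 1 are both constant is singular: the first two
  -- Laplace terms cancel by homogeneity and the others have singular minors.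
  det-constantColumns : ∀ n (M : Matrix (suc (suc n))) a b →
    (∀ r → M r zero ≡ a) → (∀ r → M r (suc zero) ≡ b) → det (suc (suc n)) M ≡ 0ℚ
  det-constantColumns n M a b col₀ col₁ = begin
      1ℚ * M zero zero * det (suc n) (minor zero M)
        + (- 1ℚ * M zero (suc zero) * det (suc n) (minor (suc zero) M) + laplaceTail n M)
        ≡⟨ cong₂ (λ x y → 1ℚ * M zero zero * x + (- 1ℚ * M zero (suc zero) * y + laplaceTail n M))
                 (det-minor zero b (col₁ ∘ suc) (λ _ _ → refl))
                 (det-minor (suc zero) a (col₀ ∘ suc) (λ _ _ → refl)) ⟩
      1ℚ * M zero zero * (b * D) + (- 1ℚ * M zero (suc zero) * (a * D) + laplaceTail n M)
        ≡⟨ cong₂ (λ x y → 1ℚ * x * (b * D) + (- 1ℚ * y * (a * D) + laplaceTail n M)) (col₀ zero) (col₁ zero) ⟩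
      1ℚ * a * (b * D) + (- 1ℚ * b * (a * D) + laplaceTail n M)
        ≡⟨ cong (λ z → 1ℚ * a * (b * D) + (- 1ℚ * b * (a * D) + z))
                (laplaceTail-vanishes n M a b (col₀ ∘ suc) (col₁ ∘ suc)) ⟩
      1ℚ * a * (b * D) + (- 1ℚ * b * (a * D) + 0ℚ)
        ≡⟨ solve 3 (λ a b d → con 1ℚ :* a :* (b :* d) :+ ((:- con 1ℚ) :* b :* (a :* d) :+ con 0ℚ) := con 0ℚ)
                 refl a b D ⟩
      0ℚ ∎
    where
    open ≡-Reasoning
    -- minors 0 and 1 differ only in column 0, which is constant (b resp. a)
    D = det (suc n) (withColumn₀ (λ _ → 1ℚ) (minor zero M))
    det-minor : ∀ j x → (∀ r → minor j M r zero ≡ x) →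
      (∀ r c → minor j M r (suc c) ≡ minor zero M r (suc c)) → det (suc n) (minor j M) ≡ x * D
    det-minor j x col rest =
      trans (det-cong (suc n) pointwise) (det-scaleColumn₀ n x (λ _ → 1ℚ) (minor zero M))
      where
      pointwise : ∀ r c → minor j M r c ≡ withColumn₀ (λ _ → x * 1ℚ) (minor zero M) r c
      pointwise r zero    = trans (col r) (sym (ℚP.*-identityʳ x))
      pointwise r (suc c) = rest r c

  laplaceTail-vanishes : ∀ n (M : Matrix (suc (suc n))) a b →
    (∀ r → M (suc r) zero ≡ a) → (∀ r → M (suc r) (suc zero) ≡ b) → laplaceTail n M ≡ 0ℚ
  laplaceTail-vanishes zero    M a b col₀ col₁ = refl
  laplaceTail-vanishes (suc n) M a b col₀ col₁ = ∑-zero (suc n) λ j →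
    trans (cong (sgn (toℕ (suc (suc j))) * M zero (suc (suc j)) *_)
                (det-constantColumns n (minor (suc (suc j)) M) a b col₀ col₁))
          (ℚP.*-zeroʳ (sgn (toℕ (suc (suc j))) * M zero (suc (suc j))))

rankOne : ∀ {n} → (Fin n → ℚ) → ℚ → Matrix n
rankOne w d r c = w c + (if same r c then d else 0ℚ)

cancel-sign : ∀ s x a b → s * s ≡ 1ℚ → (- s) * (x + 0ℚ) * (s * a * b) ≡ (- (a * b)) * x
cancel-sign s x a b s²≡1 =
  trans (solve 4 (λ s x a b → (:- s) :* (x :+ con 0ℚ) :* (s :* a :* b) := (:- ((s :* s) :* (a :* b))) :* x)
               refl s x a b)
        (trans (cong (λ z → (- (z * (a * b))) * x) s²≡1) (cong (λ z → (- z) * x) (ℚP.*-identityˡ (a * b))))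

-- Removing column 1 of rankOne w d moves the diagonal of rows ≥ 2 one step.
same-punchIn₁ : ∀ {n} (r : Fin n) (c : Fin (suc n)) → same (suc (suc r)) (punchIn (suc zero) c) ≡ same (suc r) c
same-punchIn₁ r zero    = refl
same-punchIn₁ r (suc c) = refl

mutual
  det-rankOne : ∀ n (w : Fin (suc n) → ℚ) d →
    det (suc n) (rankOne w d) ≡ d ^ℚ suc n + d ^ℚ n * ∑ (suc n) w
  det-rankOne zero w d =
    solve 2 (λ w d → con 1ℚ :* (w :+ d) :* con 1ℚ :+ con 0ℚ := d :* con 1ℚ :+ con 1ℚ :* (w :+ con 0ℚ))
          refl (w zero) d
  det-rankOne (suc n) w d = begin
      1ℚ * (w zero + d) * det (suc n) (rankOne w′ d) + ∑ (suc n) term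
        ≡⟨ cong₂ (λ x y → 1ℚ * (w zero + d) * x + y) (det-rankOne n w′ d) (∑-cong (suc n) term-value) ⟩
      1ℚ * (w zero + d) * (d ^ℚ suc n + e * S) + ∑ (suc n) (λ j → (- (w zero * e)) * w′ j)
        ≡⟨ cong (_+_ (1ℚ * (w zero + d) * (d ^ℚ suc n + e * S))) (∑-*ˡ (suc n) (- (w zero * e)) w′) ⟩
      1ℚ * (w zero + d) * (d * e + e * S) + (- (w zero * e)) * S
        ≡⟨ solve 4 (λ w₀ d e s → con 1ℚ :* (w₀ :+ d) :* (d :* e :+ e :* s) :+ (:- (w₀ :* e)) :* s
                              := d :* (d :* e) :+ (d :* e) :* (w₀ :+ s))
                 refl (w zero) d e S ⟩
      d ^ℚ suc (suc n) + d ^ℚ suc n * ∑ (suc (suc n)) w ∎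
    where
    open ≡-Reasoning
    w′ : Fin (suc n) → ℚ
    w′ x = w (suc x)
    e = d ^ℚ n
    S = ∑ (suc n) w′
    term : Fin (suc n) → ℚ
    term j = sgn (toℕ (suc j)) * (w′ j + 0ℚ) * det (suc n) (minor (suc j) (rankOne w d))
    term-value : ∀ j → term j ≡ (- (w zero * e)) * w′ j
    term-value j =
      trans (cong (sgn (toℕ (suc j)) * (w′ j + 0ℚ) *_) (det-rankOne-minor n w d j))
            (cancel-sign (sgn (toℕ j)) (w′ j) (w zero) e (sgn-square (toℕ j)))

  det-rankOne-minor : ∀ m (w : Fin (suc (suc m)) → ℚ) d (g : Fin (suc m)) →
    det (suc m) (minor (suc g) (rankOne w d)) ≡ sgn (toℕ g) * w zero * d ^ℚ m
  det-rankOne-minor zero w d zero =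
    solve 1 (λ w → con 1ℚ :* (w :+ con 0ℚ) :* con 1ℚ :+ con 0ℚ := con 1ℚ :* w :* con 1ℚ) refl (w zero)
  det-rankOne-minor (suc m) w d zero = begin
      1ℚ * (w zero + 0ℚ) * det (suc m) (rankOne w″ d) + ∑ (suc m) term
        ≡⟨ cong₂ (λ x y → 1ℚ * (w zero + 0ℚ) * x + y) (det-rankOne m w″ d) (∑-cong (suc m) term-value) ⟩
      1ℚ * (w zero + 0ℚ) * (d ^ℚ suc m + e * S) + ∑ (suc m) (λ j → (- (w zero * e)) * w″ j)
        ≡⟨ cong (_+_ (1ℚ * (w zero + 0ℚ) * (d ^ℚ suc m + e * S))) (∑-*ˡ (suc m) (- (w zero * e)) w″) ⟩
      1ℚ * (w zero + 0ℚ) * (d * e + e * S) + (- (w zero * e)) * S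
        ≡⟨ solve 4 (λ w₀ d e s → con 1ℚ :* (w₀ :+ con 0ℚ) :* (d :* e :+ e :* s) :+ (:- (w₀ :* e)) :* s
                              := con 1ℚ :* w₀ :* (d :* e))
                 refl (w zero) d e S ⟩
      1ℚ * w zero * d ^ℚ suc m ∎
    where
    open ≡-Reasoning
    w″ : Fin (suc m) → ℚ
    w″ x = w (suc (suc x))
    w∖₁ : Fin (suc (suc m)) → ℚ
    w∖₁ x = w (punchIn (suc zero) x)
    e = d ^ℚ m
    S = ∑ (suc m) w″
    K = minor (suc zero) (rankOne w d)
    term : Fin (suc m) → ℚ
    term j = sgn (toℕ (suc j)) * (w″ j + 0ℚ) * det (suc m) (minor (suc j) K)
    -- the minors of K are minors of the smaller matrix rankOne w∖₁ d
    shifted : ∀ j r c → minor (suc j) K r c ≡ minor (suc j) (rankOne w∖₁ d) r c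
    shifted j r c = cong (λ b → w∖₁ (punchIn (suc j) c) + (if b then d else 0ℚ))
                         (same-punchIn₁ r (punchIn (suc j) c))
    term-value : ∀ j → term j ≡ (- (w zero * e)) * w″ j
    term-value j =
      trans (cong (sgn (toℕ (suc j)) * (w″ j + 0ℚ) *_)
                  (trans (det-cong (suc m) (shifted j)) (det-rankOne-minor m w∖₁ d j)))
            (cancel-sign (sgn (toℕ j)) (w″ j) (w zero) e (sgn-square (toℕ j)))
  det-rankOne-minor (suc m) w d (suc g) = begin
      1ℚ * (a + 0ℚ) * det (suc m) (minor (suc g) (rankOne w′ d))
        + (- 1ℚ * (b + d) * det (suc m) (minor (suc zero) K) + laplaceTail m K)
        ≡⟨ cong₂ (λ x y → 1ℚ * (a + 0ℚ) * x + (- 1ℚ * (b + d) * y + laplaceTail m K))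
                 (det-rankOne-minor m w′ d g)
                 (trans (det-cong (suc m) minor₁-shifted) (det-rankOne-minor m w∖₁ d g)) ⟩
      1ℚ * (a + 0ℚ) * (s * b * e) + (- 1ℚ * (b + d) * (s * a * e) + laplaceTail m K)
        ≡⟨ cong (λ z → 1ℚ * (a + 0ℚ) * (s * b * e) + (- 1ℚ * (b + d) * (s * a * e) + z))
                (laplaceTail-vanishes m K (a + 0ℚ) (b + 0ℚ) (λ _ → refl) (λ _ → refl)) ⟩
      1ℚ * (a + 0ℚ) * (s * b * e) + (- 1ℚ * (b + d) * (s * a * e) + 0ℚ)
        ≡⟨ solve 5 (λ a b d e s → con 1ℚ :* (a :+ con 0ℚ) :* (s :* b :* e)
                                   :+ ((:- con 1ℚ) :* (b :+ d) :* (s :* a :* e) :+ con 0ℚ)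
                                := (:- s) :* a :* (d :* e))
                 refl a b d e s ⟩
      (- s) * a * d ^ℚ suc m ∎
    where
    open ≡-Reasoning
    a = w zero
    b = w (suc zero)
    s = sgn (toℕ g)
    e = d ^ℚ m
    w′ : Fin (suc (suc m)) → ℚ
    w′ x = w (suc x)
    w∖₁ : Fin (suc (suc m)) → ℚ
    w∖₁ x = w (punchIn (suc zero) x)
    -- columns 0 and 1 of K are constant below row 0, so its Laplace tail vanishes
    K = minor (suc (suc g)) (rankOne w d)
    minor₁-shifted : ∀ r c → minor (suc zero) K r c ≡ minor (suc g) (rankOne w∖₁ d) r c
    minor₁-shifted r zero    = refl
    minor₁-shifted r (suc c) = refl

-- Polynomials in t, as coefficient lists with the constant term first.

Poly : Set
Poly = List ℚ

infixl 6 _⊕_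
infixl 7 _⊗_ _·_

_⊕_ : Poly → Poly → Poly
[]      ⊕ q       = q
(a ∷ p) ⊕ []      = a ∷ p
(a ∷ p) ⊕ (b ∷ q) = (a + b) ∷ (p ⊕ q)

_·_ : ℚ → Poly → Poly
a · []      = []
a · (b ∷ q) = (a * b) ∷ (a · q)

_⊗_ : Poly → Poly → Poly
[]      ⊗ q = []
(a ∷ p) ⊗ q = (a · q) ⊕ (0ℚ ∷ (p ⊗ q))

ev : Poly → ℚ → ℚ
ev []      t = 0ℚ
ev (a ∷ p) t = a + t * ev p t

coeff : Poly → ℕ → ℚ
coeff []      i       = 0ℚ
coeff (a ∷ p) zero    = a
coeff (a ∷ p) (suc i) = coeff p i

ev-⊕ : ∀ p q t → ev (p ⊕ q) t ≡ ev p t + ev q t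
ev-⊕ []      q       t = sym (ℚP.+-identityˡ _)
ev-⊕ (a ∷ p) []      t = sym (ℚP.+-identityʳ _)
ev-⊕ (a ∷ p) (b ∷ q) t =
  trans (cong (λ z → a + b + t * z) (ev-⊕ p q t))
        (solve 5 (λ a b t x y → a :+ b :+ t :* (x :+ y) := a :+ t :* x :+ (b :+ t :* y)) refl
               a b t (ev p t) (ev q t))

ev-· : ∀ a p t → ev (a · p) t ≡ a * ev p t
ev-· a []      t = sym (ℚP.*-zeroʳ a)
ev-· a (b ∷ p) t =
  trans (cong (λ z → a * b + t * z) (ev-· a p t))
        (solve 4 (λ a b t x → a :* b :+ t :* (a :* x) := a :* (b :+ t :* x)) refl a b t (ev p t))

ev-⊗ : ∀ p q t → ev (p ⊗ q) t ≡ ev p t * ev q t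
ev-⊗ []      q t = sym (ℚP.*-zeroˡ (ev q t))
ev-⊗ (a ∷ p) q t = begin
    ev ((a · q) ⊕ (0ℚ ∷ (p ⊗ q))) t          ≡⟨ ev-⊕ (a · q) (0ℚ ∷ (p ⊗ q)) t ⟩
    ev (a · q) t + (0ℚ + t * ev (p ⊗ q) t)  ≡⟨ cong₂ (λ x y → x + (0ℚ + t * y)) (ev-· a q t) (ev-⊗ p q t) ⟩
    a * ev q t + (0ℚ + t * (ev p t * ev q t))
      ≡⟨ solve 4 (λ a t x y → a :* y :+ (con 0ℚ :+ t :* (x :* y)) := (a :+ t :* x) :* y) refl
               a t (ev p t) (ev q t) ⟩
    (a + t * ev p t) * ev q t ∎
  where open ≡-Reasoning

coeff-⊕ : ∀ p q i → coeff (p ⊕ q) i ≡ coeff p i + coeff q i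
coeff-⊕ []      q       i       = sym (ℚP.+-identityˡ _)
coeff-⊕ (a ∷ p) []      i       = sym (ℚP.+-identityʳ _)
coeff-⊕ (a ∷ p) (b ∷ q) zero    = refl
coeff-⊕ (a ∷ p) (b ∷ q) (suc i) = coeff-⊕ p q i

coeff-· : ∀ a p i → coeff (a · p) i ≡ a * coeff p i
coeff-· a []      i       = sym (ℚP.*-zeroʳ a)
coeff-· a (b ∷ p) zero    = refl
coeff-· a (b ∷ p) (suc i) = coeff-· a p i

coeff-⊗-∷ : ∀ a p q i → coeff ((a ∷ p) ⊗ q) i ≡ a * coeff q i + coeff (0ℚ ∷ (p ⊗ q)) i
coeff-⊗-∷ a p q i =
  trans (coeff-⊕ (a · q) (0ℚ ∷ (p ⊗ q)) i) (cong (λ x → x + coeff (0ℚ ∷ (p ⊗ q)) i) (coeff-· a q i))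

-- p is the zero polynomial (possibly with trailing zeros)
Vanishes : Poly → Set
Vanishes p = ∀ i → coeff p i ≡ 0ℚ

Deg≤ : Poly → ℕ → Set
Deg≤ p n = ∀ i → n ℕ.< i → coeff p i ≡ 0ℚ

∷-vanishes : ∀ p → Vanishes p → Vanishes (0ℚ ∷ p)
∷-vanishes p z zero    = refl
∷-vanishes p z (suc i) = z i

⊗-vanishesˡ : ∀ p q → Vanishes p → Vanishes (p ⊗ q)
⊗-vanishesˡ []      q z i = refl
⊗-vanishesˡ (a ∷ p) q z i =
  trans (coeff-⊗-∷ a p q i)
        (cong₂ _+_ (trans (cong (_* coeff q i) (z zero)) (ℚP.*-zeroˡ (coeff q i)))
                   (∷-vanishes (p ⊗ q) (⊗-vanishesˡ p q (z ∘ suc)) i))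

ev-vanishes : ∀ p t → Vanishes p → ev p t ≡ 0ℚ
ev-vanishes []      t z = refl
ev-vanishes (a ∷ p) t z =
  trans (cong₂ (λ x y → x + t * y) (z zero) (ev-vanishes p t (z ∘ suc)))
        (cong (_+_ 0ℚ) (ℚP.*-zeroʳ t))

Deg-⊕ : ∀ p q n → Deg≤ p n → Deg≤ q n → Deg≤ (p ⊕ q) n
Deg-⊕ p q n dp dq i n<i = trans (coeff-⊕ p q i) (cong₂ _+_ (dp i n<i) (dq i n<i))

Deg-· : ∀ a p n → Deg≤ p n → Deg≤ (a · p) n
Deg-· a p n dp i n<i = trans (coeff-· a p i) (trans (cong (a *_) (dp i n<i)) (ℚP.*-zeroʳ a))

⊗-leading : ∀ p q m n → Deg≤ p m → Deg≤ q n →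
  Deg≤ (p ⊗ q) (m ℕ.+ n) × coeff (p ⊗ q) (m ℕ.+ n) ≡ coeff p m * coeff q n
⊗-leading []      q m n dp dq = (λ i _ → refl) , sym (ℚP.*-zeroˡ (coeff q n))
⊗-leading (a ∷ p) q zero n dp dq = degree , scaled n
  where
  -- p vanishes, so (a ∷ p) ⊗ q is a · q
  scaled : ∀ i → coeff ((a ∷ p) ⊗ q) i ≡ a * coeff q i
  scaled i =
    trans (coeff-⊗-∷ a p q i)
          (trans (cong (_+_ (a * coeff q i))
                       (∷-vanishes (p ⊗ q) (⊗-vanishesˡ p q (λ i → dp (suc i) (s≤s z≤n))) i))
                 (ℚP.+-identityʳ (a * coeff q i)))
  degree : Deg≤ ((a ∷ p) ⊗ q) n
  degree i n<i = trans (scaled i) (trans (cong (a *_) (dq i n<i)) (ℚP.*-zeroʳ a))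
⊗-leading (a ∷ p) q (suc m) n dp dq = degree , top
  where
  ih = ⊗-leading p q m n (λ i m<i → dp (suc i) (s≤s m<i)) dq
  a·q-vanishes : ∀ i → n ℕ.< i → a * coeff q i ≡ 0ℚ
  a·q-vanishes i n<i = trans (cong (a *_) (dq i n<i)) (ℚP.*-zeroʳ a)
  degree : Deg≤ ((a ∷ p) ⊗ q) (suc m ℕ.+ n)
  degree (suc i) (s≤s m+n<i) =
    trans (coeff-⊗-∷ a p q (suc i))
          (cong₂ _+_ (a·q-vanishes (suc i) (s≤s (ℕP.≤-trans (ℕP.m≤n+m n m) (ℕP.<⇒≤ m+n<i))))
                     (proj₁ ih i m+n<i))
  top : coeff ((a ∷ p) ⊗ q) (suc m ℕ.+ n) ≡ coeff p m * coeff q n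
  top =
    trans (coeff-⊗-∷ a p q (suc m ℕ.+ n))
          (trans (cong₂ _+_ (a·q-vanishes (suc (m ℕ.+ n)) (s≤s (ℕP.m≤n+m n m))) (proj₂ ih))
                 (ℚP.+-identityˡ _))

psum : (n : ℕ) → (Fin n → Poly) → Poly
psum zero    f = []
psum (suc n) f = f zero ⊕ psum n (f ∘ suc)

ev-psum : ∀ n f t → ev (psum n f) t ≡ ∑ n (λ i → ev (f i) t)
ev-psum zero    f t = refl
ev-psum (suc n) f t =
  trans (ev-⊕ (f zero) (psum n (f ∘ suc)) t) (cong (_+_ (ev (f zero) t)) (ev-psum n (f ∘ suc) t))

coeff-psum : ∀ n f i → coeff (psum n f) i ≡ ∑ n (λ j → coeff (f j) i)
coeff-psum zero    f i = refl
coeff-psum (suc n) f i =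
  trans (coeff-⊕ (f zero) (psum n (f ∘ suc)) i) (cong (_+_ (coeff (f zero) i)) (coeff-psum n (f ∘ suc) i))

Deg-psum : ∀ n f D → (∀ j → Deg≤ (f j) D) → Deg≤ (psum n f) D
Deg-psum zero    f D df i _ = refl
Deg-psum (suc n) f D df = Deg-⊕ (f zero) (psum n (f ∘ suc)) D (df zero) (Deg-psum n (f ∘ suc) D (df ∘ suc))

pdet : (n : ℕ) → (Fin n → Fin n → Poly) → Poly
pdet zero    M = 1ℚ ∷ []
pdet (suc n) M = psum (suc n) λ j → (sgn (toℕ j) · M zero j) ⊗ pdet n (minor j M)

ev-pdet : ∀ n M t → ev (pdet n M) t ≡ det n (λ r c → ev (M r c) t)
ev-pdet zero    M t = trans (cong (_+_ 1ℚ) (ℚP.*-zeroʳ t)) (ℚP.+-identityʳ 1ℚ)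
ev-pdet (suc n) M t =
  trans (ev-psum (suc n) (λ j → (sgn (toℕ j) · M zero j) ⊗ pdet n (minor j M)) t)
        (∑-cong (suc n) λ j →
          trans (ev-⊗ (sgn (toℕ j) · M zero j) (pdet n (minor j M)) t)
                (cong₂ _*_ (ev-· (sgn (toℕ j)) (M zero j) t) (ev-pdet n (minor j M) t)))

pdet-leading : ∀ n M p → (∀ r c → Deg≤ (M r c) p) →
  Deg≤ (pdet n M) (n ℕ.* p) × coeff (pdet n M) (n ℕ.* p) ≡ det n (λ r c → coeff (M r c) p)
pdet-leading zero    M p dM = (λ { (suc i) _ → refl }) , refl
pdet-leading (suc n) M p dM =
  Deg-psum (suc n) term (suc n ℕ.* p) (proj₁ ∘ term-leading) ,
  trans (coeff-psum (suc n) term (suc n ℕ.* p)) (∑-cong (suc n) λ j →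
    trans (proj₂ (term-leading j))
          (cong₂ _*_ (coeff-· (sgn (toℕ j)) (M zero j) p) (proj₂ (minor-leading j))))
  where
  term : Fin (suc n) → Poly
  term j = (sgn (toℕ j) · M zero j) ⊗ pdet n (minor j M)
  minor-leading : ∀ j → Deg≤ (pdet n (minor j M)) (n ℕ.* p)
                        × coeff (pdet n (minor j M)) (n ℕ.* p) ≡ det n (λ r c → coeff (minor j M r c) p)
  minor-leading j = pdet-leading n (minor j M) p (λ r c → dM (suc r) (punchIn j c))
  term-leading : ∀ j → Deg≤ (term j) (p ℕ.+ n ℕ.* p)
                       × coeff (term j) (p ℕ.+ n ℕ.* p)
                         ≡ coeff (sgn (toℕ j) · M zero j) p * coeff (pdet n (minor j M)) (n ℕ.* p)
  term-leading j = ⊗-leading (sgn (toℕ j) · M zero j) (pdet n (minor j M)) p (n ℕ.* p)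
                             (Deg-· (sgn (toℕ j)) (M zero j) p (dM zero j)) (proj₁ (minor-leading j))

ev-evalPoly : ∀ D p t → Deg≤ p D → ev p t ≡ evalPoly D (λ i → coeff p (toℕ i)) t
ev-evalPoly D [] t _ = sym (∑-zero (suc D) (λ i → ℚP.*-zeroˡ (t ^ℚ toℕ i)))
ev-evalPoly zero (a ∷ p) t dp =
  trans (cong (λ z → a + t * z) (ev-vanishes p t (λ i → dp (suc i) (s≤s z≤n))))
        (solve 2 (λ a t → a :+ t :* con 0ℚ := a :* con 1ℚ :+ con 0ℚ) refl a t)
ev-evalPoly (suc D) (a ∷ p) t dp = begin
    a + t * ev p t
      ≡⟨ cong (λ z → a + t * z) (ev-evalPoly D p t (λ i D<i → dp (suc i) (s≤s D<i))) ⟩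
    a + t * ∑ (suc D) (λ i → coeff p (toℕ i) * t ^ℚ toℕ i)
      ≡⟨ cong (_+_ a) (sym (∑-*ˡ (suc D) t (λ i → coeff p (toℕ i) * t ^ℚ toℕ i))) ⟩
    a + ∑ (suc D) (λ i → t * (coeff p (toℕ i) * t ^ℚ toℕ i))
      ≡⟨ cong₂ _+_ (sym (ℚP.*-identityʳ a))
                   (∑-cong (suc D) (λ i → solve 3 (λ t c e → t :* (c :* e) := c :* (t :* e)) refl
                                                  t (coeff p (toℕ i)) (t ^ℚ toℕ i))) ⟩
    a * 1ℚ + ∑ (suc D) (λ i → coeff p (toℕ i) * (t * t ^ℚ toℕ i)) ∎
  where open ≡-Reasoning

linear : ℚ → Poly
linear x = x ∷ (- 1ℚ) ∷ []

ev-linear : ∀ x t → ev (linear x) t ≡ x - t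
ev-linear x t = solve 2 (λ x t → x :+ t :* ((:- con 1ℚ) :+ t :* con 0ℚ) := x :+ (:- t)) refl x t

_^ᴾ_ : Poly → ℕ → Poly
q ^ᴾ zero  = 1ℚ ∷ []
q ^ᴾ suc n = q ⊗ (q ^ᴾ n)

ev-^ᴾ : ∀ q n t → ev (q ^ᴾ n) t ≡ ev q t ^ℚ n
ev-^ᴾ q zero    t = trans (cong (_+_ 1ℚ) (ℚP.*-zeroʳ t)) (ℚP.+-identityʳ 1ℚ)
ev-^ᴾ q (suc n) t = trans (ev-⊗ q (q ^ᴾ n) t) (cong (ev q t *_) (ev-^ᴾ q n t))

linear-^ᴾ-leading : ∀ x n → Deg≤ (linear x ^ᴾ n) n × coeff (linear x ^ᴾ n) n ≡ sgn n
linear-^ᴾ-leading x zero    = (λ { (suc i) _ → refl }) , refl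
linear-^ᴾ-leading x (suc n) =
  proj₁ product ,
  trans (proj₂ product)
        (trans (cong ((- 1ℚ) *_) (proj₂ ih)) (solve 1 (λ s → (:- con 1ℚ) :* s := :- s) refl (sgn n)))
  where
  ih = linear-^ᴾ-leading x n
  linear-degree : Deg≤ (linear x) 1
  linear-degree (suc zero)    (s≤s ())
  linear-degree (suc (suc i)) _ = refl
  product = ⊗-leading (linear x) (linear x ^ᴾ n) 1 n linear-degree (proj₁ ih)

binom-pascal : ∀ n z → binom (suc n) z ≡ binom n z ℕ.+ binom n (z ℤ.- + 1)
binom-pascal n (+ zero)  = refl
binom-pascal n (+ suc m) = trans (sym (nCk+nC[k+1]≡[n+1]C[k+1] n m)) (ℕP.+-comm (n C m) (n C suc m))
binom-pascal n -[1+ m ]  = refl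

binom-negative : ∀ b x y → x ℕ.< y → binom b (+ x ℤ.- + y) ≡ 0
binom-negative b x y x<y =
  trans (cong (binom b) (trans (ℤP.m-n≡m⊖n x y) (ℤP.⊖-< x<y))) (negated (y ℕ.∸ x) (ℕP.m<n⇒0<n∸m x<y))
  where
  negated : ∀ n → 0 ℕ.< n → binom b (ℤ.- + n) ≡ 0
  negated (suc n) _ = refl

vandermonde : ∀ a b N → a ℕ.< N → ∀ z →
  ∑ N (λ l → ℕ→ℚ ((a C toℕ l) ℕ.* binom b (z ℤ.- + toℕ l))) ≡ ℕ→ℚ (binom (a ℕ.+ b) z)
vandermonde zero b (suc N) _ z = begin
    ℕ→ℚ (1 ℕ.* binom b (z ℤ.- + 0)) + ∑ N (λ l → ℕ→ℚ (0 ℕ.* binom b (z ℤ.- + toℕ (suc l))))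
      ≡⟨ cong₂ _+_ (cong ℕ→ℚ (trans (ℕP.*-identityˡ _) (cong (binom b) (ℤP.+-identityʳ z))))
                   (∑-zero N (λ l → refl)) ⟩
    ℕ→ℚ (binom b z) + 0ℚ ≡⟨ ℚP.+-identityʳ _ ⟩
    ℕ→ℚ (binom b z) ∎
  where open ≡-Reasoning
vandermonde (suc a) b (suc N) (s≤s a<N) z = begin
    first + ∑ N (λ l → ℕ→ℚ ((suc a C suc (toℕ l)) ℕ.* binom b (z ℤ.- + suc (toℕ l))))
      ≡⟨ cong (_+_ first) (∑-cong N pascal) ⟩
    first + ∑ N (λ l → G l + H l)
      ≡⟨ cong (_+_ first) (∑-+ N G H) ⟩
    first + (∑ N G + ∑ N H)
      ≡⟨ solve 3 (λ a b c → a :+ (b :+ c) := (a :+ c) :+ b) refl first (∑ N G) (∑ N H) ⟩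
    (first + ∑ N H) + ∑ N G
      ≡⟨ cong₂ _+_ (vandermonde a b (suc N) (ℕP.≤-trans a<N (ℕP.n≤1+n N)) z)
                   (trans (∑-cong N shiftG) (vandermonde a b N a<N (z ℤ.- + 1))) ⟩
    ℕ→ℚ (binom (a ℕ.+ b) z) + ℕ→ℚ (binom (a ℕ.+ b) (z ℤ.- + 1))
      ≡⟨ sym (trans (cong ℕ→ℚ (binom-pascal (a ℕ.+ b) z))
                  (ℕ→ℚ-+ (binom (a ℕ.+ b) z) (binom (a ℕ.+ b) (z ℤ.- + 1)))) ⟩
    ℕ→ℚ (binom (suc a ℕ.+ b) z) ∎
  where
  open ≡-Reasoning
  first = ℕ→ℚ (1 ℕ.* binom b (z ℤ.- + 0))
  -- Pascal's rule splits each term into the contributions of C(a,ℓ) and C(a,ℓ+1)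
  G H : Fin N → ℚ
  G l = ℕ→ℚ ((a C toℕ l) ℕ.* binom b (z ℤ.- + suc (toℕ l)))
  H l = ℕ→ℚ ((a C suc (toℕ l)) ℕ.* binom b (z ℤ.- + suc (toℕ l)))
  pascal : ∀ l → ℕ→ℚ ((suc a C suc (toℕ l)) ℕ.* binom b (z ℤ.- + suc (toℕ l))) ≡ G l + H l
  pascal l =
    trans (cong (λ x → ℕ→ℚ (x ℕ.* binom b (z ℤ.- + suc (toℕ l)))) (sym (nCk+nC[k+1]≡[n+1]C[k+1] a (toℕ l))))
          (ℕ→ℚ-*-distrib (a C toℕ l) (a C suc (toℕ l)) (binom b (z ℤ.- + suc (toℕ l))))
  -- the C(a,ℓ) contributions form the convolution for z - 1
  shiftG : ∀ l → G l ≡ ℕ→ℚ ((a C toℕ l) ℕ.* binom b ((z ℤ.- + 1) ℤ.- + toℕ l))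
  shiftG l = cong (λ x → ℕ→ℚ ((a C toℕ l) ℕ.* binom b x))
                  (ℤSolver.solve 2 (λ z l → z ℤSolver.:- (ℤSolver.con (+ 1) ℤSolver.:+ l)
                                         ℤSolver.:= (z ℤSolver.:- ℤSolver.con (+ 1)) ℤSolver.:- l)
                                 refl z (+ toℕ l))

binomial-sum : ∀ a N → a ℕ.< N → ∑ N (λ j → ℕ→ℚ (a C toℕ j)) ≡ ℕ→ℚ (2 ℕ.^ a)
binomial-sum zero (suc N) _ = trans (cong (_+_ (ℕ→ℚ 1)) (∑-zero N (λ l → refl))) (ℚP.+-identityʳ _)
binomial-sum (suc a) (suc N) (s≤s a<N) = begin
    ℕ→ℚ 1 + ∑ N (λ j → ℕ→ℚ (suc a C suc (toℕ j)))
      ≡⟨ cong (_+_ (ℕ→ℚ 1)) (trans (∑-cong N pascal) (∑-+ N lower upper)) ⟩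
    ℕ→ℚ 1 + (∑ N lower + ∑ N upper)
      ≡⟨ solve 3 (λ a b c → a :+ (b :+ c) := b :+ (a :+ c)) refl (ℕ→ℚ 1) (∑ N lower) (∑ N upper) ⟩
    ∑ N lower + ∑ (suc N) lower
      ≡⟨ cong₂ _+_ (binomial-sum a N a<N) (binomial-sum a (suc N) (ℕP.≤-trans a<N (ℕP.n≤1+n N))) ⟩
    ℕ→ℚ (2 ℕ.^ a) + ℕ→ℚ (2 ℕ.^ a)
      ≡⟨ sym (trans (cong (λ x → ℕ→ℚ (2 ℕ.^ a ℕ.+ x)) (ℕP.+-identityʳ (2 ℕ.^ a))) (ℕ→ℚ-+ (2 ℕ.^ a) (2 ℕ.^ a))) ⟩
    ℕ→ℚ (2 ℕ.^ suc a) ∎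
  where
  open ≡-Reasoning
  lower : ∀ {n} → Fin n → ℚ
  lower j = ℕ→ℚ (a C toℕ j)
  upper : Fin N → ℚ
  upper j = ℕ→ℚ (a C suc (toℕ j))
  pascal : ∀ j → ℕ→ℚ (suc a C suc (toℕ j)) ≡ lower j + upper j
  pascal j = trans (cong ℕ→ℚ (sym (nCk+nC[k+1]≡[n+1]C[k+1] a (toℕ j)))) (ℕ→ℚ-+ (a C toℕ j) (a C suc (toℕ j)))

sgn-odd : ∀ {p} → Odd p → sgn p ≡ - 1ℚ
sgn-odd (m , refl) = cong -_ (sgn-even m)
  where
  sgn-even : ∀ m → sgn (2 ℕ.* m) ≡ 1ℚ
  sgn-even zero    = refl
  sgn-even (suc m) =
    trans (cong sgn (ℕP.*-suc 2 m)) (trans (solve 1 (λ s → :- (:- s) := s) refl (sgn (2 ℕ.* m))) (sgn-even m))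

^ℚ-neg : ∀ y n → (- y) ^ℚ n ≡ sgn n * y ^ℚ n
^ℚ-neg y zero    = refl
^ℚ-neg y (suc n) =
  trans (cong ((- y) *_) (^ℚ-neg y n))
        (solve 3 (λ y s e → (:- y) :* (s :* e) := (:- s) :* (y :* e)) refl y (sgn n) (y ^ℚ n))

∣∣^odd-nonpos : ∀ y {p} → Odd p → y ℚ.≤ 0ℚ → ℚ.∣ y ∣ ^ℚ p ≡ (- 1ℚ) * y ^ℚ p
∣∣^odd-nonpos y {p} odd y≤0 =
  trans (cong (_^ℚ p) (trans (sym (ℚP.∣-p∣≡∣p∣ y)) (ℚP.0≤p⇒∣p∣≡p (ℚP.neg-antimono-≤ y≤0))))
        (trans (^ℚ-neg y p) (cong (_* (y ^ℚ p)) (sgn-odd odd)))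

∣∣^-nonneg : ∀ y p → 0ℚ ℚ.≤ y → ℚ.∣ y ∣ ^ℚ p ≡ 1ℚ * y ^ℚ p
∣∣^-nonneg y p 0≤y = trans (cong (_^ℚ p) (ℚP.0≤p⇒∣p∣≡p 0≤y)) (sym (ℚP.*-identityˡ _))

weight : (k : ℕ) → (i j l : Fin (suc k)) → ℕ
weight k i j l = binom (toℕ i) (+ toℕ l) ℕ.* binom (k ℕ.∸ toℕ i) (+ toℕ j ℤ.- + toℕ l)

node : (k : ℕ) → (i j l : Fin (suc k)) → ℤ
node k i j l = + (2 ℕ.* toℕ i ℕ.+ 2 ℕ.* toℕ j) ℤ.- + k ℤ.- + (4 ℕ.* toℕ l)

-- the node lies left of the interval exactly when i + j ≤ 2ℓ
left? : ∀ {k} (i j l : Fin (suc k)) → Dec (toℕ i ℕ.+ toℕ j ≤ 2 ℕ.* toℕ l)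
left? i j l = (toℕ i ℕ.+ toℕ j) ℕ.≤? (2 ℕ.* toℕ l)

sideSign : ∀ {P : Set} → Dec P → ℚ
sideSign (yes _) = - 1ℚ
sideSign (no _)  = 1ℚ

onLeft : ∀ {P : Set} → Dec P → ℚ → ℚ
onLeft (yes _) c = c
onLeft (no _)  c = 0ℚ

entryTerm : (k p : ℕ) → (i j l : Fin (suc k)) → Poly
entryTerm k p i j l = (ℕ→ℚ (weight k i j l) * sideSign (left? i j l)) · (linear (ℤ→ℚ (node k i j l)) ^ᴾ p)

entryPoly : (k p : ℕ) → Fin (suc k) → Fin (suc k) → Poly
entryPoly k p i j = psum (suc k) (entryTerm k p i j)

entryPoly-degree : ∀ k p i j → Deg≤ (entryPoly k p i j) p
entryPoly-degree k p i j = Deg-psum (suc k) (entryTerm k p i j) p λ l →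
  Deg-· (ℕ→ℚ (weight k i j l) * sideSign (left? i j l)) (linear (ℤ→ℚ (node k i j l)) ^ᴾ p) p
        (proj₁ (linear-^ᴾ-leading (ℤ→ℚ (node k i j l)) p))

node-as-ℚ : ∀ a k b → ℤ→ℚ (+ a ℤ.- + k ℤ.- + b) ≡ ℕ→ℚ a - ℕ→ℚ k - ℕ→ℚ b
node-as-ℚ a k b = trans (ℤ→ℚ-- (+ a ℤ.- + k) (+ b)) (cong (_- ℕ→ℚ b) (ℤ→ℚ-- (+ a) (+ k)))

x≤y⇒x-y≤0 : ∀ {x y} → x ℚ.≤ y → x - y ℚ.≤ 0ℚ
x≤y⇒x-y≤0 {x} {y} x≤y = ℚP.≤-trans (ℚP.+-monoˡ-≤ (- y) x≤y) (ℚP.≤-reflexive (ℚP.+-inverseʳ y))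

x≤y⇒0≤y-x : ∀ {x y} → x ℚ.≤ y → 0ℚ ℚ.≤ y - x
x≤y⇒0≤y-x {x} {y} x≤y = ℚP.≤-trans (ℚP.≤-reflexive (sym (ℚP.+-inverseʳ x))) (ℚP.+-monoˡ-≤ (- x) x≤y)

left-of-interval : ∀ A B K t → A ℚ.≤ B → - K ℚ.≤ t → A - K - B - t ℚ.≤ 0ℚ
left-of-interval A B K t A≤B -K≤t = begin
    A - K - B - t
      ≡⟨ solve 4 (λ A B K t → A :+ (:- K) :+ (:- B) :+ (:- t) := (A :+ (:- B)) :+ ((:- K) :+ (:- t))) refl A B K t ⟩
    (A - B) + (- K - t) ≤⟨ ℚP.+-mono-≤ (x≤y⇒x-y≤0 A≤B) (x≤y⇒x-y≤0 -K≤t) ⟩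
    0ℚ ∎
  where open ℚP.≤-Reasoning

right-of-interval : ∀ A B K T t → B + T ℚ.≤ A → t ℚ.≤ - K + T → 0ℚ ℚ.≤ A - K - B - t
right-of-interval A B K T t B+T≤A t≤T-K = begin
    0ℚ ≤⟨ ℚP.+-mono-≤ (x≤y⇒0≤y-x B+T≤A) (x≤y⇒0≤y-x t≤T-K) ⟩
    (A - (B + T)) + ((- K + T) - t)
      ≡⟨ solve 5 (λ A B K T t → (A :+ (:- (B :+ T))) :+ ((:- K :+ T) :+ (:- t)) := A :+ (:- K) :+ (:- B) :+ (:- t))
               refl A B K T t ⟩
    A - K - B - t ∎
  where open ℚP.≤-Reasoning

-- i + j ≤ 2ℓ puts the node 2i+2j-k-4ℓ at or below -k ...
left⇒ : ∀ a b l → a ℕ.+ b ≤ 2 ℕ.* l → 2 ℕ.* a ℕ.+ 2 ℕ.* b ≤ 4 ℕ.* l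
left⇒ a b l a+b≤2l = subst₂ _≤_ (ℕP.*-distribˡ-+ 2 a b) (sym (ℕP.*-assoc 2 2 l)) (ℕP.*-monoʳ-≤ 2 a+b≤2l)

-- ... and i + j > 2ℓ puts it at or above -k+2.
right⇒ : ∀ a b l → ¬ (a ℕ.+ b ≤ 2 ℕ.* l) → 4 ℕ.* l ℕ.+ 2 ≤ 2 ℕ.* a ℕ.+ 2 ℕ.* b
right⇒ a b l a+b≰2l = subst₂ _≤_ double (ℕP.*-distribˡ-+ 2 a b) (ℕP.*-monoʳ-≤ 2 (ℕP.≰⇒> a+b≰2l))
  where
  double : 2 ℕ.* suc (2 ℕ.* l) ≡ 4 ℕ.* l ℕ.+ 2
  double = trans (ℕP.*-suc 2 (2 ℕ.* l)) (trans (cong (2 ℕ.+_) (sym (ℕP.*-assoc 2 2 l))) (ℕP.+-comm 2 (4 ℕ.* l)))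

module OnInterval (k p : ℕ) (odd : Odd p) (t : ℚ)
                  (-k≤t : - ℕ→ℚ k ℚ.≤ t) (t≤2-k : t ℚ.≤ - ℕ→ℚ k + ℕ→ℚ 2) where

  node-left : ∀ i j l → toℕ i ℕ.+ toℕ j ≤ 2 ℕ.* toℕ l → ℤ→ℚ (node k i j l) - t ℚ.≤ 0ℚ
  node-left i j l left =
    subst (ℚ._≤ 0ℚ) (sym (cong (_- t) (node-as-ℚ A k B)))
          (left-of-interval (ℕ→ℚ A) (ℕ→ℚ B) (ℕ→ℚ k) t (ℕ→ℚ-mono (left⇒ (toℕ i) (toℕ j) (toℕ l) left)) -k≤t)
    where A = 2 ℕ.* toℕ i ℕ.+ 2 ℕ.* toℕ j ; B = 4 ℕ.* toℕ l

  node-right : ∀ i j l → ¬ (toℕ i ℕ.+ toℕ j ≤ 2 ℕ.* toℕ l) → 0ℚ ℚ.≤ ℤ→ℚ (node k i j l) - t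
  node-right i j l right =
    subst (0ℚ ℚ.≤_) (sym (cong (_- t) (node-as-ℚ A k B)))
          (right-of-interval (ℕ→ℚ A) (ℕ→ℚ B) (ℕ→ℚ k) (ℕ→ℚ 2) t B+2≤A t≤2-k)
    where
    A = 2 ℕ.* toℕ i ℕ.+ 2 ℕ.* toℕ j
    B = 4 ℕ.* toℕ l
    B+2≤A : ℕ→ℚ B + ℕ→ℚ 2 ℚ.≤ ℕ→ℚ A
    B+2≤A = subst (ℚ._≤ ℕ→ℚ A) (ℕ→ℚ-+ B 2) (ℕ→ℚ-mono (right⇒ (toℕ i) (toℕ j) (toℕ l) right))

  abs-power : ∀ i j l →
    ℚ.∣ ℤ→ℚ (node k i j l) - t ∣ ^ℚ p ≡ sideSign (left? i j l) * (ℤ→ℚ (node k i j l) - t) ^ℚ p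
  abs-power i j l with left? i j l
  ... | yes left = ∣∣^odd-nonpos _ odd (node-left i j l left)
  ... | no right = ∣∣^-nonneg _ p (node-right i j l right)

  Mk-entry : ∀ i j → Mk k p t i j ≡ ev (entryPoly k p i j) t
  Mk-entry i j = sym (trans (ev-psum (suc k) (entryTerm k p i j) t) (∑-cong (suc k) term-value))
    where
    term-value : ∀ l → ev (entryTerm k p i j l) t
                     ≡ ℕ→ℚ (weight k i j l) * (ℚ.∣ ℤ→ℚ (node k i j l) - t ∣ ^ℚ p)
    term-value l = begin
        ev (entryTerm k p i j l) t
          ≡⟨ ev-· (c * s) (linear x ^ᴾ p) t ⟩
        (c * s) * ev (linear x ^ᴾ p) t
          ≡⟨ cong ((c * s) *_) (trans (ev-^ᴾ (linear x) p t) (cong (_^ℚ p) (ev-linear x t))) ⟩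
        (c * s) * (x - t) ^ℚ p
          ≡⟨ ℚP.*-assoc c s ((x - t) ^ℚ p) ⟩
        c * (s * (x - t) ^ℚ p)
          ≡⟨ cong (c *_) (sym (abs-power i j l)) ⟩
        c * (ℚ.∣ x - t ∣ ^ℚ p) ∎
      where
      open ≡-Reasoning
      c = ℕ→ℚ (weight k i j l)
      s = sideSign (left? i j l)
      x = ℤ→ℚ (node k i j l)

weight-sum : ∀ k (i j : Fin (suc k)) → ∑ (suc k) (λ l → ℕ→ℚ (weight k i j l)) ≡ ℕ→ℚ (k C toℕ j)
weight-sum k i j =
  trans (vandermonde (toℕ i) (k ℕ.∸ toℕ i) (suc k) (FinP.toℕ<n i) (+ toℕ j))
        (cong (λ n → ℕ→ℚ (binom n (+ toℕ j))) (ℕP.m+[n∸m]≡n (ℕP.≤-pred (FinP.toℕ<n i))))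

δδ : ∀ {n} → Fin n → Fin n → Fin n → ℚ
δδ l i j = if same l i then (if same i j then 1ℚ else 0ℚ) else 0ℚ

δδ-zero : ∀ {n} (l i j : Fin n) → ¬ (toℕ l ≡ toℕ i × toℕ i ≡ toℕ j) → δδ l i j ≡ 0ℚ
δδ-zero l i j ¬diag with toℕ l ℕ.≟ toℕ i
... | no  l≢i rewrite same-≢ l i l≢i = refl
... | yes l≡i rewrite same-≡ l i l≡i | same-≢ i j (λ i≡j → ¬diag (l≡i , i≡j)) = refl

δδ-one : ∀ {n} (l i j : Fin n) → toℕ l ≡ toℕ i → toℕ i ≡ toℕ j → δδ l i j ≡ 1ℚ
δδ-one l i j l≡i i≡j rewrite same-≡ l i l≡i | same-≡ i j i≡j = refl

diagonal-squeeze : ∀ a b m → a ℕ.+ b ≤ 2 ℕ.* m → m ≤ a → m ≤ b → m ≡ a × a ≡ b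
diagonal-squeeze a b m a+b≤2m m≤a m≤b = m≡a , trans (sym m≡a) (ℕP.≤-antisym m≤b b≤m)
  where
  a+b≤m+m : a ℕ.+ b ≤ m ℕ.+ m
  a+b≤m+m = subst (a ℕ.+ b ≤_) (cong (m ℕ.+_) (ℕP.+-identityʳ m)) a+b≤2m
  a≤m : a ≤ m
  a≤m = ℕP.+-cancelʳ-≤ m a m (ℕP.≤-trans (ℕP.+-monoʳ-≤ a m≤b) a+b≤m+m)
  b≤m : b ≤ m
  b≤m = ℕP.+-cancelˡ-≤ m b m (ℕP.≤-trans (ℕP.+-monoˡ-≤ b m≤a) a+b≤m+m)
  m≡a : m ≡ a
  m≡a = ℕP.≤-antisym m≤a a≤m

on-diagonal-left : ∀ {a b m} → m ≡ a → a ≡ b → a ℕ.+ b ≤ 2 ℕ.* m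
on-diagonal-left {m = m} refl refl = ℕP.≤-reflexive (cong (m ℕ.+_) (sym (ℕP.+-identityʳ m)))

left-weight : ∀ k (i j l : Fin (suc k)) → onLeft (left? i j l) (ℕ→ℚ (weight k i j l)) ≡ δδ l i j
left-weight k i j l with left? i j l
... | no right = sym (δδ-zero l i j (λ (l≡i , i≡j) → right (on-diagonal-left l≡i i≡j)))
... | yes left with toℕ l ℕ.≤? toℕ i | toℕ l ℕ.≤? toℕ j
...   | no l≰i | _ =
  trans (cong (λ x → ℕ→ℚ (x ℕ.* binom (k ℕ.∸ toℕ i) (+ toℕ j ℤ.- + toℕ l))) (k>n⇒nCk≡0 (ℕP.≰⇒> l≰i)))
        (sym (δδ-zero l i j (λ (l≡i , _) → l≰i (ℕP.≤-reflexive l≡i))))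
...   | yes _ | no l≰j =
  trans (cong ℕ→ℚ (trans (cong (binom (toℕ i) (+ toℕ l) ℕ.*_) (binom-negative (k ℕ.∸ toℕ i) (toℕ j) (toℕ l) (ℕP.≰⇒> l≰j)))
                         (ℕP.*-zeroʳ (binom (toℕ i) (+ toℕ l)))))
        (sym (δδ-zero l i j (λ (l≡i , i≡j) → l≰j (ℕP.≤-reflexive (trans l≡i i≡j)))))
...   | yes l≤i | yes l≤j with diagonal-squeeze (toℕ i) (toℕ j) (toℕ l) left l≤i l≤j
...     | l≡i , i≡j = trans (cong ℕ→ℚ diagonal-weight) (sym (δδ-one l i j l≡i i≡j))
  where
  diagonal-weight : weight k i j l ≡ 1
  diagonal-weight =
    trans (cong₂ (λ u v → (toℕ i C u) ℕ.* binom (k ℕ.∸ toℕ i) (+ v ℤ.- + u)) l≡i (sym i≡j))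
          (cong₂ ℕ._*_ (nCn≡1 (toℕ i)) (cong (binom (k ℕ.∸ toℕ i)) (ℤP.+-inverseʳ (+ toℕ i))))

leadingMatrix : (k : ℕ) → Matrix (suc k)
leadingMatrix k = rankOne (λ j → - ℕ→ℚ (k C toℕ j)) (ℕ→ℚ 2)

signed-weight-leading : ∀ {P : Set} (d : Dec P) c → (c * sideSign d) * (- 1ℚ) ≡ (- 1ℚ) * c + ℕ→ℚ 2 * onLeft d c
signed-weight-leading (yes _) c =
  solve 1 (λ c → c :* (:- con 1ℚ) :* (:- con 1ℚ) := (:- con 1ℚ) :* c :+ con (ℕ→ℚ 2) :* c) refl c
signed-weight-leading (no _) c =
  solve 1 (λ c → c :* con 1ℚ :* (:- con 1ℚ) := (:- con 1ℚ) :* c :+ con (ℕ→ℚ 2) :* con 0ℚ) refl c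

entry-leading : ∀ k p → Odd p → ∀ i j → coeff (entryPoly k p i j) p ≡ leadingMatrix k i j
entry-leading k p odd i j = begin
    coeff (entryPoly k p i j) p
      ≡⟨ coeff-psum (suc k) (entryTerm k p i j) p ⟩
    ∑ (suc k) (λ l → coeff (entryTerm k p i j l) p)
      ≡⟨ ∑-cong (suc k) term-coeff ⟩
    ∑ (suc k) (λ l → (- 1ℚ) * c l + ℕ→ℚ 2 * onLeft (left? i j l) (c l))
      ≡⟨ ∑-+ (suc k) (λ l → (- 1ℚ) * c l) (λ l → ℕ→ℚ 2 * onLeft (left? i j l) (c l)) ⟩
    ∑ (suc k) (λ l → (- 1ℚ) * c l) + ∑ (suc k) (λ l → ℕ→ℚ 2 * onLeft (left? i j l) (c l))
      ≡⟨ cong₂ _+_ (∑-*ˡ (suc k) (- 1ℚ) c) (∑-*ˡ (suc k) (ℕ→ℚ 2) (λ l → onLeft (left? i j l) (c l))) ⟩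
    (- 1ℚ) * ∑ (suc k) c + ℕ→ℚ 2 * ∑ (suc k) (λ l → onLeft (left? i j l) (c l))
      ≡⟨ cong₂ (λ x y → (- 1ℚ) * x + ℕ→ℚ 2 * y) (weight-sum k i j)
               (trans (∑-cong (suc k) (left-weight k i j)) (∑-δ (suc k) i (if same i j then 1ℚ else 0ℚ))) ⟩
    (- 1ℚ) * ℕ→ℚ (k C toℕ j) + ℕ→ℚ 2 * (if same i j then 1ℚ else 0ℚ)
      ≡⟨ diagonal (same i j) (ℕ→ℚ (k C toℕ j)) ⟩
    leadingMatrix k i j ∎
  where
  open ≡-Reasoning
  c : Fin (suc k) → ℚ
  c l = ℕ→ℚ (weight k i j l)
  term-coeff : ∀ l → coeff (entryTerm k p i j l) p ≡ (- 1ℚ) * c l + ℕ→ℚ 2 * onLeft (left? i j l) (c l)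
  term-coeff l =
    trans (coeff-· (c l * sideSign (left? i j l)) (linear (ℤ→ℚ (node k i j l)) ^ᴾ p) p)
          (trans (cong ((c l * sideSign (left? i j l)) *_)
                       (trans (proj₂ (linear-^ᴾ-leading (ℤ→ℚ (node k i j l)) p)) (sgn-odd odd)))
                 (signed-weight-leading (left? i j l) (c l)))
  diagonal : ∀ b x → (- 1ℚ) * x + ℕ→ℚ 2 * (if b then 1ℚ else 0ℚ) ≡ - x + (if b then ℕ→ℚ 2 else 0ℚ)
  diagonal true  x = solve 1 (λ x → (:- con 1ℚ) :* x :+ con (ℕ→ℚ 2) :* con 1ℚ := (:- x) :+ con (ℕ→ℚ 2)) refl x
  diagonal false x = solve 1 (λ x → (:- con 1ℚ) :* x :+ con (ℕ→ℚ 2) :* con 0ℚ := (:- x) :+ con 0ℚ) refl x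

det-leadingMatrix : ∀ k → det (suc k) (leadingMatrix k) ≡ ℤ→ℚ (+ (2 ℕ.^ k) ℤ.* (+ 2 ℤ.- + (2 ℕ.^ k)))
det-leadingMatrix k = begin
    det (suc k) (leadingMatrix k)
      ≡⟨ det-rankOne k (λ j → - ℕ→ℚ (k C toℕ j)) (ℕ→ℚ 2) ⟩
    ℕ→ℚ 2 * ℕ→ℚ 2 ^ℚ k + ℕ→ℚ 2 ^ℚ k * ∑ (suc k) (λ j → - ℕ→ℚ (k C toℕ j))
      ≡⟨ cong₂ (λ x y → ℕ→ℚ 2 * x + x * y) (sym (ℕ→ℚ-^ 2 k)) column-sum ⟩
    ℕ→ℚ 2 * X + X * ((- 1ℚ) * X)
      ≡⟨ solve 2 (λ t x → t :* x :+ x :* ((:- con 1ℚ) :* x) := x :* (t :+ (:- x))) refl (ℕ→ℚ 2) X ⟩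
    X * (ℕ→ℚ 2 - X)
      ≡⟨ sym (trans (ℤ→ℚ-* (+ (2 ℕ.^ k)) (+ 2 ℤ.- + (2 ℕ.^ k))) (cong (X *_) (ℤ→ℚ-- (+ 2) (+ (2 ℕ.^ k))))) ⟩
    ℤ→ℚ (+ (2 ℕ.^ k) ℤ.* (+ 2 ℤ.- + (2 ℕ.^ k))) ∎
  where
  open ≡-Reasoning
  X = ℕ→ℚ (2 ℕ.^ k)
  column-sum : ∑ (suc k) (λ j → - ℕ→ℚ (k C toℕ j)) ≡ (- 1ℚ) * X
  column-sum =
    trans (∑-cong (suc k) (λ j → solve 1 (λ c → :- c := (:- con 1ℚ) :* c) refl (ℕ→ℚ (k C toℕ j))))
          (trans (∑-*ˡ (suc k) (- 1ℚ) (λ j → ℕ→ℚ (k C toℕ j)))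
                 (cong ((- 1ℚ) *_) (binomial-sum k (suc k) (ℕP.n<1+n k))))

-- 2^k (2 - 2^k) ≠ 0 once k ≥ 2, since then 2^k ≥ 4.
leading-nonzero : ∀ k → 2 ≤ k → + (2 ℕ.^ k) ℤ.* (+ 2 ℤ.- + (2 ℕ.^ k)) ≢ + 0
leading-nonzero k 2≤k eq with ℤP.i*j≡0⇒i≡0∨j≡0 (+ (2 ℕ.^ k)) eq
... | inj₁ 2^k≡0 = ℕP.<-irrefl (sym (ℤP.+-injective 2^k≡0)) (ℕP.m^n>0 2 k)
... | inj₂ 2-2^k≡0 =
  four≰two (ℕP.≤-trans (ℕP.^-monoʳ-≤ 2 2≤k)
                       (ℕP.≤-reflexive (sym (ℤP.+-injective (ℤP.i-j≡0⇒i≡j (+ 2) (+ (2 ℕ.^ k)) 2-2^k≡0)))))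
  where
  four≰two : ¬ (4 ≤ 2)
  four≰two (s≤s (s≤s ()))

lemma4p6 : (k p : ℕ) → 1 ≤ k → Odd p →
    ∃ λ (c : Fin (suc (suc k ℕ.* p)) → ℚ) →
      ((t : ℚ) → ℚ.- ℕ→ℚ k ℚ.≤ t → t ℚ.≤ ℚ.- ℕ→ℚ k ℚ.+ ℕ→ℚ 2 →
        det (suc k) (Mk k p t) ≡ evalPoly (suc k ℕ.* p) c t)
      × c (fromℕ (suc k ℕ.* p)) ≡ ℤ→ℚ (+ (2 ℕ.^ k) ℤ.* (+ 2 ℤ.- + (2 ℕ.^ k)))
      × (2 ≤ k → c (fromℕ (suc k ℕ.* p)) ≢ 0ℚ)
lemma4p6 k p _ odd = coefficients , agrees , top-coefficient , top-nonzero
  where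
  D = suc k ℕ.* p
  P = pdet (suc k) (entryPoly k p)
  leading = pdet-leading (suc k) (entryPoly k p) p (entryPoly-degree k p)
  coefficients : Fin (suc D) → ℚ
  coefficients i = coeff P (toℕ i)
  agrees : (t : ℚ) → - ℕ→ℚ k ℚ.≤ t → t ℚ.≤ - ℕ→ℚ k + ℕ→ℚ 2 → det (suc k) (Mk k p t) ≡ evalPoly D coefficients t
  agrees t -k≤t t≤2-k =
    trans (det-cong (suc k) (OnInterval.Mk-entry k p odd t -k≤t t≤2-k))
          (trans (sym (ev-pdet (suc k) (entryPoly k p) t)) (ev-evalPoly D P t (proj₁ leading)))
  top-coefficient : coefficients (fromℕ D) ≡ ℤ→ℚ (+ (2 ℕ.^ k) ℤ.* (+ 2 ℤ.- + (2 ℕ.^ k)))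
  top-coefficient =
    trans (cong (coeff P) (FinP.toℕ-fromℕ D))
          (trans (proj₂ leading) (trans (det-cong (suc k) (entry-leading k p odd)) (det-leadingMatrix k)))
  top-nonzero : 2 ≤ k → coefficients (fromℕ D) ≢ 0ℚ
  top-nonzero 2≤k eq = leading-nonzero k 2≤k (ℤ→ℚ-zero _ (trans (sym top-coefficient) eq))
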